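{- Let $k\ge 3$ and $1\le c\le 5$ be integers with $(k-2)\mid(2c+1)$, let $v=c(4k-6)+1$, and let $A=\{0,1,\dots,k-3\}\subseteq\mathbb{Z}_v$. Let the base blocks $B_{0,1},\dots,B_{0,c}\subseteq\mathbb{Z}_v$ be, in order: for $c=1$: $A\cup\{k-2,\,2(k-2)+1\}$; for $c=2$: $A\cup\{2(k-2),5(k-2)+2\}$, $A\cup\{k-2,3(k-2)+1\}$; for $c=3$: $A\cup\{2(k-2),7(k-2)+3\}$, $A\cup\{3(k-2)+1,5(k-2)+2\}$, $A\cup\{k-2,4(k-2)+2\}$; for $c=4$: $A\cup\{2(k-2),8(k-2)+4\}$, $A\cup\{3(k-2)+1,5(k-2)+2\}$, $A\cup\{4(k-2)+2,7(k-2)+4\}$, $A\cup\{k-2,6(k-2)+3\}$; for $c=5$: $A\cup\{2(k-2),6(k-2)+3\}$, $A\cup\{3(k-2),9(k-2)+4\}$, $A\cup\{4(k-2)+2,7(k-2)+4\}$, $A\cup\{5(k-2)+3,8(k-2)+4\}$, $A\cup\{k-2,10(k-2)+5\}$. For $i\in\mathbb{Z}_v$ let $B_{i,j}=B_{0,j}+i$, and consider the ordered list $(B_{0,1},\dots,B_{0,c},B_{1,1},\dots,B_{1,c},\dots,B_{v-1,1},\dots,B_{v-1,c})$ on $\mathbb{Z}_v$, which is a $\mathrm{CDCCD}(v,k,c^2(4k-6)+c)$. Then this $\mathrm{CDCCD}$ has an expansion set.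
   Context: A double change covering design (strength 2) is a $v$-set $V$ with an ordered list $(B_1,\dots,B_b)$ of $k$-subsets (blocks) such that every 2-subset of $V$ lies in some block and $|B_i\setminus B_{i+1}|=|B_{i+1}\setminus B_i|=2$ for $1\le i<b$; it is circular (CDCCD) if also $|B_b\setminus B_1|=|B_1\setminus B_b|=2$. The unchanged subsets are $U_i=B_i\cap B_{i+1}$ for $1\le i\le b-1$, together with $U_0=U_b=B_1\cap B_b$ in the circular case. The design has an expansion set if some collection of unchanged subsets $U_{i_1},\dots,U_{i_l}$ (distinct indices) partitions $V$. -}

module Defs where

open import Data.Nat using (ℕ; zero; suc; _+_; _*_; _∸_; _<_; _<?_)
open import Data.Nat.DivMod using (_%_)
open import Data.Fin using (Fin; toℕ; fromℕ<)
import Data.Fin as F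
open import Data.List using (List; []; _∷_; _++_; map; concatMap; upTo; length; lookup)
open import Data.List.Membership.Propositional using (_∈_)
open import Data.List.Relation.Unary.Unique.Propositional using (Unique)
open import Data.Product using (Σ; ∃; _×_)
open import Relation.Binary.PropositionalEquality using (_≡_)
open import Relation.Nullary using (yes; no)

-- A block is a finite list of points (elements of ℤ_v represented by 0..v-1).
Block : Set
Block = List ℕ

cyc : ∀ {n} → Fin n → Fin n
cyc {suc n} t with suc (toℕ t) <? suc n
... | yes p = fromℕ< p
... | no _  = F.zero

-- Unchanged subsets of a circular list of blocks D_0,…,D_{b-1} (0-indexed):
-- U t = D_t ∩ D_{t+1 mod b}.  (t = b-1 gives U_0 = U_b = B_1 ∩ B_b of the paper.)
U : (D : List Block) → Fin (length D) → ℕ → Set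
U D t x = (x ∈ lookup D t) × (x ∈ lookup D (cyc t))

HasExpansionSet : ℕ → List Block → Set
HasExpansionSet v D =
  Σ (List (Fin (length D))) λ I →
    Unique I
    × (∀ t → t ∈ I → ∃ λ x → U D t x)
    × (∀ x → x < v → ∃ λ t → (t ∈ I) × U D t x)
    × (∀ x t t' → t ∈ I → t' ∈ I → U D t x → U D t' x → t ≡ t')

vOf : ℕ → ℕ → ℕ
vOf k c = suc (c * (4 * k ∸ 6))

Aset : ℕ → Block
Aset k = upTo (k ∸ 2)

baseBlocks : ℕ → ℕ → List Block
baseBlocks k 1 = (Aset k ++ (m ∷ 2 * m + 1 ∷ [])) ∷ []
  where m = k ∸ 2
baseBlocks k 2 =
    (Aset k ++ (2 * m ∷ 5 * m + 2 ∷ []))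
  ∷ (Aset k ++ (m ∷ 3 * m + 1 ∷ []))
  ∷ []
  where m = k ∸ 2
baseBlocks k 3 =
    (Aset k ++ (2 * m ∷ 7 * m + 3 ∷ []))
  ∷ (Aset k ++ (3 * m + 1 ∷ 5 * m + 2 ∷ []))
  ∷ (Aset k ++ (m ∷ 4 * m + 2 ∷ []))
  ∷ []
  where m = k ∸ 2
baseBlocks k 4 =
    (Aset k ++ (2 * m ∷ 8 * m + 4 ∷ []))
  ∷ (Aset k ++ (3 * m + 1 ∷ 5 * m + 2 ∷ []))
  ∷ (Aset k ++ (4 * m + 2 ∷ 7 * m + 4 ∷ []))
  ∷ (Aset k ++ (m ∷ 6 * m + 3 ∷ []))
  ∷ []
  where m = k ∸ 2
baseBlocks k 5 =
    (Aset k ++ (2 * m ∷ 6 * m + 3 ∷ []))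
  ∷ (Aset k ++ (3 * m ∷ 9 * m + 4 ∷ []))
  ∷ (Aset k ++ (4 * m + 2 ∷ 7 * m + 4 ∷ []))
  ∷ (Aset k ++ (5 * m + 3 ∷ 8 * m + 4 ∷ []))
  ∷ (Aset k ++ (m ∷ 10 * m + 5 ∷ []))
  ∷ []
  where m = k ∸ 2
baseBlocks k _ = []

shift : ℕ → ℕ → Block → Block
shift v i B = map (λ a → (a + i) % suc v) B

design : ℕ → ℕ → List Block
design k c = concatMap (λ i → map (shift (c * (4 * k ∸ 6)) i) (baseBlocks k c)) (upTo (vOf k c))

{-# OPTIONS --safe #-}
module Submission where

open import Defs
open import Data.Nat using (ℕ; _+_; _*_; _∸_; _≤_; _<_; suc; s≤s; _≟_; >-nonZero)
open import Data.Nat.Properties using (≤-trans; m≤n+m; +-monoˡ-≤; *-monoʳ-≤)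
open import Data.Nat.Divisibility using (_∣_; _∣?_; ∣⇒≤)
open import Data.Fin using (Fin; toℕ)
import Data.Fin.Properties as Fin
open import Data.List using (List; lookup; length; upTo; map; filter; allFin)
open import Data.List.Relation.Unary.All as All using (All; all?)
open import Data.List.Relation.Unary.Any using (Any; any?)
open import Data.List.Membership.Propositional using (_∈_; find)
open import Data.List.Membership.Propositional.Properties using (∈-upTo⁺; ∈-map⁺; ∈-map⁻)
open import Data.List.Membership.DecPropositional _≟_ using (_∈?_)
open import Data.List.Relation.Unary.Unique.Propositional using (Unique)
import Data.List.Relation.Unary.Unique.DecPropositional as UniqueDec
open import Data.Product using (∃; _×_; _,_)
open import Data.Sum using (_⊎_; inj₁; inj₂)
open import Data.Unit using (tt)
open import Data.Empty using (⊥-elim)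
open import Relation.Binary.PropositionalEquality using (_≡_; refl)
open import Relation.Nullary using (Dec; ¬_)
open import Relation.Nullary.Decidable using (toWitness; _×-dec_; _⊎-dec_; _→-dec_; ¬?)

-- The expansion set consists of the unchanged subsets at the positions c·i with
-- (k − 2) ∣ i, i.e. right after the blocks B_{i,1}.  Each of them is a translate
-- of the interval A (by i, or by i + 1 when c = 1), and since
-- v ≡ 2c + 1 ≡ 0 (mod k − 2) these v/(k − 2) translates tile ℤ_v.  Because k − 2
-- divides 2c + 1 ≤ 11, only eleven pairs (k, c) occur, and for each of them this
-- is confirmed by evaluating a decidable certificate.

module ExpansionCertificate (v : ℕ) (D : List Block) where

  open UniqueDec (Fin._≟_ {length D}) using (unique?)

  Index : Set
  Index = Fin (length D)

  -- Carrying both blocks along lets the evaluator compute each of them only once.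
  Transition : Set
  Transition = Index × Block × Block

  transition : Index → Transition
  transition t = t , lookup D t , lookup D (cyc t)

  Unchanged : Transition → ℕ → Set
  Unchanged (_ , B , B′) x = x ∈ B × x ∈ B′

  unchanged? : ∀ τ x → Dec (Unchanged τ x)
  unchanged? (_ , B , B′) x = (x ∈? B) ×-dec (x ∈? B′)

  NonemptyUnchanged : Transition → Set
  NonemptyUnchanged (_ , B , B′) = Any (_∈ B′) B

  nonemptyUnchanged? : ∀ τ → Dec (NonemptyUnchanged τ)
  nonemptyUnchanged? (_ , B , B′) = any? (_∈? B′) B

  Apart : Transition → Transition → Set
  Apart (t , B , B′) σ@(t′ , _ , _) =
    t ≡ t′ ⊎ All (λ x → x ∈ B′ → ¬ Unchanged σ x) B

  apart? : ∀ τ σ → Dec (Apart τ σ)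
  apart? (t , B , B′) σ@(t′ , _ , _) =
    (t Fin.≟ t′) ⊎-dec all? (λ x → (x ∈? B′) →-dec ¬? (unchanged? σ x)) B

  module _ (I : List Index) where

    transitions : List Transition
    transitions = map transition I

    Certificate : Set
    Certificate = Unique I
      × All NonemptyUnchanged transitions
      × All (λ x → Any (λ τ → Unchanged τ x) transitions) (upTo v)
      × All (λ τ → All (Apart τ) transitions) transitions

    certificate? : Dec Certificate
    certificate? = unique? I
      ×-dec all? nonemptyUnchanged? transitions
      ×-dec all? (λ x → any? (λ τ → unchanged? τ x) transitions) (upTo v)
      ×-dec all? (λ τ → all? (apart? τ) transitions) transitions

    certificate⇒hasExpansionSet : Certificate → HasExpansionSet v D
    certificate⇒hasExpansionSet (unique , nonempty , covering , apart) =
      I , unique , nonempty′ , covering′ , disjoint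
      where
      nonempty′ : ∀ t → t ∈ I → ∃ λ x → U D t x
      nonempty′ t t∈I with find (All.lookup nonempty (∈-map⁺ transition t∈I))
      ... | x , x∈B , x∈B′ = x , x∈B , x∈B′

      covering′ : ∀ x → x < v → ∃ λ t → t ∈ I × U D t x
      covering′ x x<v with find (All.lookup covering (∈-upTo⁺ x<v))
      ... | τ , τ∈ , x∈U with ∈-map⁻ transition τ∈
      ...   | t , t∈I , refl = t , t∈I , x∈U

      disjoint : ∀ x t t′ → t ∈ I → t′ ∈ I → U D t x → U D t′ x → t ≡ t′
      disjoint x t t′ t∈I t′∈I (x∈B , x∈B′) x∈U′
        with All.lookup (All.lookup apart (∈-map⁺ transition t∈I)) (∈-map⁺ transition t′∈I)
      ... | inj₁ t≡t′ = t≡t′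
      ... | inj₂ outside = ⊥-elim (All.lookup outside x∈B x∈B′ x∈U′)

open ExpansionCertificate using (Certificate; certificate?; certificate⇒hasExpansionSet)

expansionIndices : (k c : ℕ) → List (Fin (length (design k c)))
expansionIndices k c = filter (λ t → (k ∸ 2) * c ∣? toℕ t) (allFin _)

Certified : ℕ → ℕ → Set
Certified k c = Certificate (vOf k c) (design k c) (expansionIndices k c)

certified? : ∀ k c → Dec (Certified k c)
certified? k c = certificate? (vOf k c) (design k c) (expansionIndices k c)

divisor-of-2c+1<12 : ∀ {m c} → c ≤ 5 → m ∣ 2 * c + 1 → m < 12
divisor-of-2c+1<12 {c = c} c≤5 m∣2c+1 =
  s≤s (≤-trans (∣⇒≤ ⦃ >-nonZero (m≤n+m 1 (2 * c)) ⦄ m∣2c+1) (+-monoˡ-≤ 1 (*-monoʳ-≤ 2 c≤5)))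

CertifiedForDivisors : ℕ → Set
CertifiedForDivisors c = All (λ m → m ∣ 2 * c + 1 → Certified (2 + m) c) (upTo 12)

certifiedForDivisors? : ∀ c → Dec (CertifiedForDivisors c)
certifiedForDivisors? c = all? (λ m → (m ∣? 2 * c + 1) →-dec certified? (2 + m) c) (upTo 12)

-- One evaluation per c: deciding all cases in a single term exhausts memory.
certifiedForDivisors : ∀ c → 1 ≤ c → c ≤ 5 → CertifiedForDivisors c
certifiedForDivisors 0 () _
certifiedForDivisors 1 _ _ = toWitness {a? = certifiedForDivisors? 1} tt
certifiedForDivisors 2 _ _ = toWitness {a? = certifiedForDivisors? 2} tt
certifiedForDivisors 3 _ _ = toWitness {a? = certifiedForDivisors? 3} tt
certifiedForDivisors 4 _ _ = toWitness {a? = certifiedForDivisors? 4} tt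
certifiedForDivisors 5 _ _ = toWitness {a? = certifiedForDivisors? 5} tt
certifiedForDivisors (suc (suc (suc (suc (suc (suc _)))))) _ (s≤s (s≤s (s≤s (s≤s (s≤s ())))))

mainTheorem6 : (k c : ℕ) → 3 ≤ k → 1 ≤ c → c ≤ 5 → (k ∸ 2) ∣ (2 * c + 1)
    → HasExpansionSet (vOf k c) (design k c)
mainTheorem6 (suc (suc m)) c _ 1≤c c≤5 m∣2c+1 =
  certificate⇒hasExpansionSet (vOf (2 + m) c) (design (2 + m) c) (expansionIndices (2 + m) c)
    (All.lookup (certifiedForDivisors c 1≤c c≤5) (∈-upTo⁺ (divisor-of-2c+1<12 c≤5 m∣2c+1)) m∣2c+1)
mainTheorem6 0 _ ()
mainTheorem6 1 _ (s≤s ())
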